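{- Let $d\ge 2$ and let $\mathcal{F}\subseteq 2^{[n]}$ be a $d$-saturated family. (i) Assume that no two distinct elements of $[n]$ are duplicates with respect to $\mathcal{F}$. Let $x_1,\ldots,x_m\in[n]$ be such that for every $F\in\mathcal{F}$ and every $i$, the set $F\triangle\{x_i\}$ does not belong to $\mathcal{F}$. Then every family $\mathcal{F}'$ obtained from $\mathcal{F}$ by duplicating some of $x_1,\ldots,x_m$ (any number of times) is $d$-saturated (as a family on its enlarged ground set). (ii) For every $x\in[n]$ with $|D(x)|\ge 2$ and every $F\in\mathcal{F}$, the set $F\triangle D(x)$ does not belong to $\mathcal{F}$.
   Context: For $\mathcal{F}\subseteq 2^{[n]}$ and a set $X$, $\mathcal{F}|_X=\{F\cap X:F\in\mathcal{F}\}$; $\mathcal{F}$ shatters $X$ if $\mathcal{F}|_X=2^X$; $VC(\mathcal{F})$ is the largest size of a shattered set. A family $\mathcal{F}\subseteq 2^{Y}$ on ground set $Y$ is saturated if $VC(\mathcal{F})<VC(\mathcal{F}')$ for every $\mathcal{F}'\subseteq 2^{Y}$ with $\mathcal{F}'\supsetneq\mathcal{F}$, and $d$-saturated if moreover $VC(\mathcal{F})=d$. Two elements $x,y\in[n]$ are duplicates (with respect to $\mathcal{F}$) if for every $F\in\mathcal{F}$, $x\in F$ iff $y\in F$; $D(x)\subseteq[n]$ is the set of all duplicates of $x$, including $x$ itself. $\triangle$ denotes symmetric difference. Duplicating an element $x$ means: add new elements $y_1,\dots,y_t$ to the ground set and replace each $F\in\mathcal{F}$ by $F\cup\{y_1,\dots,y_t\}$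 if $x\in F$ and leave $F$ unchanged if $x\notin F$ (so the new elements become duplicates of $x$); duplicating several of the $x_i$ is done in the same way for each of them. -}

module Defs where

open import Data.Nat using (ℕ; _≤_; _<_; _+_)
open import Data.Bool using (Bool; _xor_)
open import Data.Fin using (Fin; zero; suc)
open import Data.Fin.Subset using (Subset; _∈_; _⊆_; _∩_; ∣_∣)
open import Data.Vec using (zipWith; tabulate; lookup)
open import Data.List using (List; []; _∷_; length; map)
open import Data.List.Membership.Propositional renaming (_∈_ to _∈ᶠ_; _∉_ to _∉ᶠ_)
open import Data.Product using (Σ; ∃; _×_)
open import Relation.Binary.PropositionalEquality using (_≡_)

-- A family of subsets of the ground set [n] = Fin n, given as a finite list
-- (repetitions are irrelevant; membership is list membership).
Family : ℕ → Set
Family n = List (Subset n)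

_△_ : ∀ {n} → Subset n → Subset n → Subset n
p △ q = zipWith _xor_ p q

Shatters : ∀ {n} → Family n → Subset n → Set
Shatters 𝓕 X = ∀ Y → Y ⊆ X → ∃ λ F → F ∈ᶠ 𝓕 × F ∩ X ≡ Y

VC : ∀ {n} → Family n → ℕ → Set
VC 𝓕 d = (∃ λ X → Shatters 𝓕 X × ∣ X ∣ ≡ d) × (∀ X → Shatters 𝓕 X → ∣ X ∣ ≤ d)

_⊋ᶠ_ : ∀ {n} → Family n → Family n → Set
𝓕' ⊋ᶠ 𝓕 = (∀ F → F ∈ᶠ 𝓕 → F ∈ᶠ 𝓕') × (∃ λ F → F ∈ᶠ 𝓕' × F ∉ᶠ 𝓕)

Saturated : ∀ {n} → ℕ → Family n → Set
Saturated {n} d 𝓕 = VC 𝓕 d × (∀ (𝓕' : Family n) → 𝓕' ⊋ᶠ 𝓕 → ∀ d' → VC 𝓕' d' → d < d')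

Duplicates : ∀ {n} → Family n → Fin n → Fin n → Set
Duplicates 𝓕 x y = ∀ F → F ∈ᶠ 𝓕 → (x ∈ F → y ∈ F) × (y ∈ F → x ∈ F)

-- Given a list ys of elements of [n] (each occurrence of y in
-- ys yields one new copy of y), the enlarged ground set is
-- Fin (length ys + n): the first  length ys  elements are the new copies
-- (the k-th one being a copy of the k-th entry of ys) and the last n are
-- the original elements.  dupMap sends each element to the original it is a copy of.
dupMap : ∀ {n} (ys : List (Fin n)) → Fin (length ys + n) → Fin n
dupMap [] i = i
dupMap (y ∷ ys) zero = y
dupMap (y ∷ ys) (suc i) = dupMap ys i

dupSet : ∀ {n} (ys : List (Fin n)) → Subset n → Subset (length ys + n)
dupSet ys F = tabulate (λ j → lookup F (dupMap ys j))

dupFamily : ∀ {n} (ys : List (Fin n)) → Family n → Family (length ys + n)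
dupFamily ys 𝓕 = map (dupSet ys) 𝓕

-- (ii) Let y ≠ z lie in D. The set F △ {y} separates the duplicates y and z, so it is not in 𝓕,
-- and by saturation (F △ {y}) ∷ 𝓕 shatters some S with |S| > d. Only F △ {y} can separate two
-- elements of D, so S meets D at most in y, and on S the set F △ {y} coincides with F or with
-- F △ D. Were F △ D in 𝓕, then 𝓕 alone would shatter S.
--
-- (i) A shattered set never contains two copies of one element, and reading sets through dupMap,
-- or through a section of it, transports shattering; so duplication keeps the VC dimension. Let H
-- lie in a strictly larger family 𝓖 and let K be H read on the original elements. If K ∉ 𝓕, then
-- K ∷ 𝓕 shatters a set larger than d, which 𝓖 shatters through the section. Otherwise H differs
-- from the duplicate of K at some copy j of an element x, necessarily one of the xᵢ; reading H
-- through the section that uses j for x yields K △ {x} ∉ 𝓕, and the same argument applies.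

module Submission where

open import Defs
open import Data.Nat using (ℕ; _≤_)
open import Data.Fin using (Fin)
open import Data.Fin.Subset using (Subset; _∈_; ∣_∣; ⁅_⁆)
open import Data.List using (List)
open import Data.List.Relation.Unary.All using (All)
open import Data.List.Membership.Propositional renaming (_∈_ to _∈ᶠ_; _∉_ to _∉ᶠ_)
open import Data.Product using (∃; _×_)
open import Relation.Binary.PropositionalEquality using (_≡_)

open import Data.Bool using (true; false; not; _∧_; _xor_) renaming (_≟_ to _≟ᵇ_)
open import Data.Bool.Properties using (∧-identityʳ; ∧-zeroʳ; xor-identityʳ; xor-comm; ¬-not; not-¬; ⇔→≡)
open import Data.Fin using (zero; suc; _↑ʳ_) renaming (_≟_ to _≟ᶠ_)
open import Data.Fin.Properties using (↑ʳ-injective; suc-injective; 0≢1+n; all?; ¬∀⟶∃¬)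
open import Data.Fin.Subset using (⊥; _∪_; _∩_; _⊆_; Nonempty)
open import Data.Fin.Subset.Properties
  using (_∈?_; _⊆?_; anySubset?; ∉⊥; ∣⊥∣≡0; ∣p∣≤n; x∈⁅x⁆; x∈⁅y⁆⇒x≡y; q⊆p∪q; x∈p∪q⁺; x∈p∪q⁻; p∩q⊆q; p⊂q⇒∣p∣<∣q∣)
open import Data.List using ([]; _∷_; length)
open import Data.List.Membership.Propositional using (find; lose)
open import Data.List.Membership.Propositional.Properties using (∈-map⁺; ∈-map⁻)
import Data.List.Relation.Unary.All as All
open import Data.List.Relation.Unary.Any using (Any; here; there; any?)
open import Data.Nat using (zero; suc; _+_; _<_; z≤n; s≤s) renaming (_≟_ to _≟ⁿ_)
open import Data.Nat.Properties using (≤-trans; ≤-antisym; ≤-pred; ≤∧≢⇒<; <⇒≱; <-≤-trans)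
open import Data.Product using (∃₂; _,_; proj₁; proj₂)
open import Data.Sum using (inj₁; inj₂)
import Data.Vec as Vec
open import Data.Vec using (lookup; tabulate; []; _∷_)
open import Data.Vec.Properties using (lookup-zipWith; lookup∘tabulate; tabulate∘lookup; tabulate-cong; []=⇒lookup; lookup⇒[]=; ≡-dec)
open import Function using (_∘_; id)
open import Function.Bundles using (mk⇔)
open import Relation.Binary.PropositionalEquality using (_≢_; refl; sym; trans; cong; subst; module ≡-Reasoning)
open import Relation.Nullary using (Dec; yes; no; ¬_; contradiction)
open import Relation.Nullary.Decidable using (map′; _×-dec_; ¬?; decidable-stable)

open ≡-Reasoning

private variable
  m n d d′ : ℕ

infix 4 _≟ˢ_
_≟ˢ_ : (p q : Subset n) → Dec (p ≡ q)
_≟ˢ_ = ≡-dec _≟ᵇ_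

Subset-ext : {p q : Subset n} → (∀ i → lookup p i ≡ lookup q i) → p ≡ q
Subset-ext {p = p} {q} p≗q = begin
  p                   ≡⟨ tabulate∘lookup p ⟨
  tabulate (lookup p) ≡⟨ tabulate-cong p≗q ⟩
  tabulate (lookup q) ≡⟨ tabulate∘lookup q ⟩
  q                   ∎

lookup-∩ : ∀ (p q : Subset n) i → lookup (p ∩ q) i ≡ lookup p i ∧ lookup q i
lookup-∩ p q i = lookup-zipWith _∧_ i p q

lookup-△ : ∀ (p q : Subset n) i → lookup (p △ q) i ≡ lookup p i xor lookup q i
lookup-△ p q i = lookup-zipWith _xor_ i p q

lookup-⁅x⁆ : ∀ (x : Fin n) → lookup ⁅ x ⁆ x ≡ true
lookup-⁅x⁆ x = []=⇒lookup (x∈⁅x⁆ x)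

lookup-⁅y⁆ : ∀ {i} (x : Fin n) → i ≢ x → lookup ⁅ x ⁆ i ≡ false
lookup-⁅y⁆ {i = i} x i≢x = ¬-not (i≢x ∘ x∈⁅y⁆⇒x≡y x ∘ lookup⇒[]= i ⁅ x ⁆)

trace⇒agree : ∀ {F X Y : Subset n} {x} → F ∩ X ≡ Y → x ∈ X → lookup F x ≡ lookup Y x
trace⇒agree {F = F} {X} {x = x} refl x∈X = begin
  lookup F x              ≡⟨ ∧-identityʳ _ ⟨
  lookup F x ∧ true       ≡⟨ cong (lookup F x ∧_) ([]=⇒lookup x∈X) ⟨
  lookup F x ∧ lookup X x ≡⟨ lookup-∩ F X x ⟨
  lookup (F ∩ X) x        ∎

agree⇒trace : ∀ {F X Y : Subset n} → Y ⊆ X → (∀ x → x ∈ X → lookup F x ≡ lookup Y x) → F ∩ X ≡ Y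
agree⇒trace {F = F} {X} {Y} Y⊆X agree = Subset-ext pointwise
  where
  pointwise : ∀ x → lookup (F ∩ X) x ≡ lookup Y x
  pointwise x rewrite lookup-∩ F X x with lookup X x in X[x]
  ... | true  = trans (∧-identityʳ _) (agree x (lookup⇒[]= x X X[x]))
  ... | false = trans (∧-zeroʳ _) (sym (¬-not λ Y[x] →
                  contradiction (trans (sym X[x]) ([]=⇒lookup (Y⊆X (lookup⇒[]= x Y Y[x])))) λ ()))

Shatters-⊥ : ∀ {𝓐 : Family n} {F} → F ∈ᶠ 𝓐 → Shatters 𝓐 ⊥
Shatters-⊥ F∈ Y Y⊆⊥ = _ , F∈ , agree⇒trace Y⊆⊥ (λ _ x∈⊥ → contradiction x∈⊥ ∉⊥)

shatters⇒separates : ∀ {𝓐 : Family n} {X a b} → Shatters 𝓐 X → a ∈ X → b ∈ X → b ≢ a →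
                     ∃ λ A → A ∈ᶠ 𝓐 × lookup A a ≡ true × lookup A b ≡ false
shatters⇒separates {X = X} {a} sh a∈X b∈X b≢a =
  let (A , A∈ , A∩X≡⁅a⁆) = sh ⁅ a ⁆ ⁅a⁆⊆X
  in A , A∈ , trans (trace⇒agree A∩X≡⁅a⁆ a∈X) (lookup-⁅x⁆ a)
            , trans (trace⇒agree A∩X≡⁅a⁆ b∈X) (lookup-⁅y⁆ a b≢a)
  where
  ⁅a⁆⊆X : ⁅ a ⁆ ⊆ X
  ⁅a⁆⊆X x∈⁅a⁆ = subst (_∈ X) (sym (x∈⁅y⁆⇒x≡y a x∈⁅a⁆)) a∈X

Shatters? : (𝓐 : Family n) (X : Subset n) → Dec (Shatters 𝓐 X)
Shatters? {n} 𝓐 X = map′ noCounterexample⇒shatters shatters⇒noCounterexample (¬? (anySubset? counterexample?))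
  where
  Traced : Subset n → Set
  Traced Y = Any (λ F → F ∩ X ≡ Y) 𝓐
  traced? : ∀ Y → Dec (Traced Y)
  traced? Y = any? (λ F → F ∩ X ≟ˢ Y) 𝓐
  counterexample? : ∀ Y → Dec (Y ⊆ X × ¬ Traced Y)
  counterexample? Y = (Y ⊆? X) ×-dec ¬? (traced? Y)
  noCounterexample⇒shatters : ¬ (∃ λ Y → Y ⊆ X × ¬ Traced Y) → Shatters 𝓐 X
  noCounterexample⇒shatters none Y Y⊆X =
    find (decidable-stable (traced? Y) λ untraced → none (Y , Y⊆X , untraced))
  shatters⇒noCounterexample : Shatters 𝓐 X → ¬ (∃ λ Y → Y ⊆ X × ¬ Traced Y)
  shatters⇒noCounterexample sh (Y , Y⊆X , untraced) =
    let (F , F∈ , F∩X≡Y) = sh Y Y⊆X in untraced (lose F∈ F∩X≡Y)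

greatest : ∀ {P : ℕ → Set} → (∀ k → Dec (P k)) → P 0 → (∀ {k} → P k → k ≤ n) →
           ∃ λ k → P k × (∀ {j} → P j → j ≤ k)
greatest {zero}  P? p₀ bounded = 0 , p₀ , bounded
greatest {suc n} {P} P? p₀ bounded with P? (suc n)
... | yes pₙ = suc n , pₙ , bounded
... | no ¬pₙ = greatest P? p₀ λ pⱼ → ≤-pred (≤∧≢⇒< (bounded pⱼ) λ j≡n → ¬pₙ (subst P j≡n pⱼ))

VC-exists : ∀ {𝓐 : Family n} {F} → F ∈ᶠ 𝓐 → ∃ (VC 𝓐)
VC-exists {n} {𝓐} F∈ =
  let (d , shattered , maximal) = greatest {P = ShatteredOfSize} shatteredOfSize?
        (⊥ , Shatters-⊥ F∈ , ∣⊥∣≡0 n) (λ (X , _ , ∣X∣≡k) → subst (_≤ n) ∣X∣≡k (∣p∣≤n X))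
  in d , shattered , λ X sh → maximal (X , sh , refl)
  where
  ShatteredOfSize : ℕ → Set
  ShatteredOfSize k = ∃ λ X → Shatters 𝓐 X × ∣ X ∣ ≡ k
  shatteredOfSize? : ∀ k → Dec (ShatteredOfSize k)
  shatteredOfSize? k = anySubset? λ X → Shatters? 𝓐 X ×-dec (∣ X ∣ ≟ⁿ k)

saturated-extension : ∀ {𝓐 : Family n} {L} → Saturated d 𝓐 → L ∉ᶠ 𝓐 →
                      ∃ λ S → Shatters (L ∷ 𝓐) S × d < ∣ S ∣
saturated-extension {𝓐 = 𝓐} {L} (_ , grows) L∉ =
  let (d′ , vc) = VC-exists (here refl)
      ((S , sh , ∣S∣≡d′) , _) = vc
  in S , sh , subst (_ <_) (sym ∣S∣≡d′) (grows (L ∷ 𝓐) ((λ _ → there) , L , here refl , L∉) d′ vc)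

image : (Fin m → Fin n) → Subset m → Subset n
image g []          = ⊥
image g (false ∷ S) = image (g ∘ suc) S
image g (true ∷ S)  = ⁅ g zero ⁆ ∪ image (g ∘ suc) S

∈-image⁻ : ∀ (g : Fin m → Fin n) S {t} → t ∈ image g S → ∃ λ s → s ∈ S × g s ≡ t
∈-image⁻ g []          t∈ = contradiction t∈ ∉⊥
∈-image⁻ g (false ∷ S) t∈ = let (s , s∈ , gs≡t) = ∈-image⁻ (g ∘ suc) S t∈ in suc s , Vec.there s∈ , gs≡t
∈-image⁻ g (true ∷ S)  t∈ with x∈p∪q⁻ ⁅ g zero ⁆ (image (g ∘ suc) S) t∈
... | inj₁ t∈⁅g0⁆ = zero , Vec.here , sym (x∈⁅y⁆⇒x≡y (g zero) t∈⁅g0⁆)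
... | inj₂ t∈img  = let (s , s∈ , gs≡t) = ∈-image⁻ (g ∘ suc) S t∈img in suc s , Vec.there s∈ , gs≡t

InjectiveOn : (Fin m → Fin n) → Subset m → Set
InjectiveOn g S = ∀ {s t} → s ∈ S → t ∈ S → g s ≡ g t → s ≡ t

InjectiveOn-∷ : ∀ {g : Fin (suc m) → Fin n} {b S} → InjectiveOn g (b ∷ S) → InjectiveOn (g ∘ suc) S
InjectiveOn-∷ inj s∈ t∈ gs≡gt = suc-injective (inj (Vec.there s∈) (Vec.there t∈) gs≡gt)

∣S∣≤∣image∣ : ∀ (g : Fin m → Fin n) S → InjectiveOn g S → ∣ S ∣ ≤ ∣ image g S ∣
∣S∣≤∣image∣ g []          inj = z≤n
∣S∣≤∣image∣ g (false ∷ S) inj = ∣S∣≤∣image∣ (g ∘ suc) S (InjectiveOn-∷ inj)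
∣S∣≤∣image∣ g (true ∷ S)  inj = ≤-trans (s≤s (∣S∣≤∣image∣ (g ∘ suc) S (InjectiveOn-∷ inj)))
  (p⊂q⇒∣p∣<∣q∣ (q⊆p∪q _ _ , g zero , x∈p∪q⁺ (inj₁ (x∈⁅x⁆ (g zero))) , g0∉))
  where
  g0∉ : ¬ g zero ∈ image (g ∘ suc) S
  g0∉ g0∈ = let (s , s∈ , gs≡g0) = ∈-image⁻ (g ∘ suc) S g0∈ in 0≢1+n (sym (inj (Vec.there s∈) Vec.here gs≡g0))

Simulates : (Fin m → Fin n) → Subset m → Family m → Family n → Set
Simulates g S 𝓐 𝓑 = ∀ A → A ∈ᶠ 𝓐 → ∃ λ B → B ∈ᶠ 𝓑 × (∀ s → s ∈ S → lookup B (g s) ≡ lookup A s)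

shatters-image : ∀ {𝓐 : Family m} {𝓑 : Family n} {g S} → Shatters 𝓐 S → Simulates g S 𝓐 𝓑 →
                 Shatters 𝓑 (image g S)
shatters-image {𝓑 = 𝓑} {g} {S} sh sim Y Y⊆ =
  let (A , A∈ , A∩S≡Y′) = sh Y′ (p∩q⊆q _ S)
      (B , B∈ , B∘g≗A) = sim A A∈
      B∘g≗Y∘g : ∀ s → s ∈ S → lookup B (g s) ≡ lookup Y (g s)
      B∘g≗Y∘g s s∈ = begin
        lookup B (g s)  ≡⟨ B∘g≗A s s∈ ⟩
        lookup A s      ≡⟨ trace⇒agree A∩S≡Y′ s∈ ⟩
        lookup Y′ s     ≡⟨ trace⇒agree {F = Y∘g} refl s∈ ⟨
        lookup Y∘g s    ≡⟨ lookup∘tabulate (lookup Y ∘ g) s ⟩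
        lookup Y (g s)  ∎
  in B , B∈ , agree⇒trace Y⊆ λ t t∈ →
       let (s , s∈ , gs≡t) = ∈-image⁻ g S t∈ in subst (λ u → lookup B u ≡ lookup Y u) gs≡t (B∘g≗Y∘g s s∈)
  where
  Y∘g = tabulate (lookup Y ∘ g)
  Y′ = Y∘g ∩ S

≤-VC : ∀ {𝓐 : Family m} {𝓑 : Family n} {g S} → VC 𝓑 d → Shatters 𝓐 S → InjectiveOn g S →
       Simulates g S 𝓐 𝓑 → ∣ S ∣ ≤ d
≤-VC {g = g} {S} (_ , maximal) sh inj sim = ≤-trans (∣S∣≤∣image∣ g S inj) (maximal _ (shatters-image sh sim))

saturated-<-VC : ∀ {𝓐 : Family m} {𝓑 : Family n} {L g} → Saturated d 𝓐 → VC 𝓑 d′ → L ∉ᶠ 𝓐 →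
                 (∀ {s t} → g s ≡ g t → s ≡ t) → (∀ {S} → Simulates g S (L ∷ 𝓐) 𝓑) → d < d′
saturated-<-VC sat vc L∉ inj sim =
  let (S , sh , d<∣S∣) = saturated-extension sat L∉ in <-≤-trans d<∣S∣ (≤-VC vc sh (λ _ _ → inj) sim)

Duplicates-sym : ∀ {𝓐 : Family n} {a b} → Duplicates 𝓐 a b → Duplicates 𝓐 b a
Duplicates-sym dup A A∈ = let (a⇒b , b⇒a) = dup A A∈ in b⇒a , a⇒b

Duplicates-trans : ∀ {𝓐 : Family n} {a b c} → Duplicates 𝓐 a b → Duplicates 𝓐 b c → Duplicates 𝓐 a c
Duplicates-trans dup dup′ A A∈ =
  let (a⇒b , b⇒a) = dup A A∈ ; (b⇒c , c⇒b) = dup′ A A∈ in b⇒c ∘ a⇒b , b⇒a ∘ c⇒b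

Duplicates⇒lookup≡ : ∀ {𝓐 : Family n} {a b A} → Duplicates 𝓐 a b → A ∈ᶠ 𝓐 → lookup A a ≡ lookup A b
Duplicates⇒lookup≡ {a = a} {b} {A} dup A∈ = let (a⇒b , b⇒a) = dup A A∈ in ⇔→≡ (mk⇔
  (λ A[a] → []=⇒lookup (a⇒b (lookup⇒[]= a A A[a])))
  (λ A[b] → []=⇒lookup (b⇒a (lookup⇒[]= b A A[b]))))

lookup≡⇒Duplicates : ∀ {𝓐 : Family n} {a b} → (∀ A → A ∈ᶠ 𝓐 → lookup A a ≡ lookup A b) → Duplicates 𝓐 a b
lookup≡⇒Duplicates {a = a} {b} A[a]≡A[b] A A∈ =
  (λ a∈A → lookup⇒[]= b A (trans (sym (A[a]≡A[b] A A∈)) ([]=⇒lookup a∈A))) ,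
  (λ b∈A → lookup⇒[]= a A (trans (A[a]≡A[b] A A∈) ([]=⇒lookup b∈A)))

shatters-duplicates⇒≡ : ∀ {𝓐 : Family n} {S a b} → Duplicates 𝓐 a b → Shatters 𝓐 S → a ∈ S → b ∈ S → a ≡ b
shatters-duplicates⇒≡ {a = a} {b} dup sh a∈S b∈S with a ≟ᶠ b
... | yes a≡b = a≡b
... | no  a≢b = let (A , A∈ , A[a] , A[b]) = shatters⇒separates sh a∈S b∈S (a≢b ∘ sym) in
  contradiction (trans (sym A[a]) (trans (Duplicates⇒lookup≡ dup A∈) A[b])) λ ()

∷-shatters-duplicates⇒≡ : ∀ {𝓐 : Family n} {H S a b} → Duplicates 𝓐 a b → Shatters (H ∷ 𝓐) S →
                          a ∈ S → b ∈ S → a ≡ b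
∷-shatters-duplicates⇒≡ {𝓐 = 𝓐} {H} {a = a} {b} dup sh a∈S b∈S with a ≟ᶠ b
... | yes a≡b = a≡b
... | no  a≢b =
  let (A , A∈ , A[a] , A[b]) = shatters⇒separates sh a∈S b∈S (a≢b ∘ sym)
      (B , B∈ , B[b] , B[a]) = shatters⇒separates sh b∈S a∈S a≢b
  in contradiction (trans (sym (proj₂ (only-H-separates dup A∈ A[a] A[b])))
                          (proj₁ (only-H-separates (Duplicates-sym dup) B∈ B[b] B[a]))) λ ()
  where
  only-H-separates : ∀ {x y A} → Duplicates 𝓐 x y → A ∈ᶠ H ∷ 𝓐 → lookup A x ≡ true → lookup A y ≡ false →
                     lookup H x ≡ true × lookup H y ≡ false
  only-H-separates _   (here refl) A[x] A[y] = A[x] , A[y]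
  only-H-separates dup (there A∈)  A[x] A[y] =
    contradiction (trans (sym A[x]) (trans (Duplicates⇒lookup≡ dup A∈) A[y])) λ ()

△⁅⁆∉ : ∀ {𝓐 : Family n} {F a b} → Duplicates 𝓐 a b → a ≢ b → F ∈ᶠ 𝓐 → F △ ⁅ a ⁆ ∉ᶠ 𝓐
△⁅⁆∉ {F = F} {a} {b} dup a≢b F∈ F△⁅a⁆∈ = not-¬ refl (sym flipped)
  where
  flipped : not (lookup F a) ≡ lookup F a
  flipped = begin
    not (lookup F a)                  ≡⟨ xor-comm (lookup F a) true ⟨
    lookup F a xor true               ≡⟨ cong (lookup F a xor_) (lookup-⁅x⁆ a) ⟨
    lookup F a xor lookup ⁅ a ⁆ a     ≡⟨ lookup-△ F ⁅ a ⁆ a ⟨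
    lookup (F △ ⁅ a ⁆) a              ≡⟨ Duplicates⇒lookup≡ dup F△⁅a⁆∈ ⟩
    lookup (F △ ⁅ a ⁆) b              ≡⟨ lookup-△ F ⁅ a ⁆ b ⟩
    lookup F b xor lookup ⁅ a ⁆ b     ≡⟨ cong (lookup F b xor_) (lookup-⁅y⁆ a (a≢b ∘ sym)) ⟩
    lookup F b xor false              ≡⟨ xor-identityʳ _ ⟩
    lookup F b                        ≡⟨ Duplicates⇒lookup≡ dup F∈ ⟨
    lookup F a                        ∎

1≤∣p∣⇒Nonempty : ∀ (p : Subset n) → 1 ≤ ∣ p ∣ → Nonempty p
1≤∣p∣⇒Nonempty (true ∷ p)  _    = zero , Vec.here
1≤∣p∣⇒Nonempty (false ∷ p) 1≤∣p∣ = let (x , x∈p) = 1≤∣p∣⇒Nonempty p 1≤∣p∣ in suc x , Vec.there x∈p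

2≤∣p∣⇒two-elements : ∀ (p : Subset n) → 2 ≤ ∣ p ∣ → ∃₂ λ x y → x ∈ p × y ∈ p × x ≢ y
2≤∣p∣⇒two-elements (true ∷ p)  (s≤s 1≤∣p∣) =
  let (y , y∈p) = 1≤∣p∣⇒Nonempty p 1≤∣p∣ in zero , suc y , Vec.here , Vec.there y∈p , 0≢1+n
2≤∣p∣⇒two-elements (false ∷ p) 2≤∣p∣ =
  let (x , y , x∈p , y∈p , x≢y) = 2≤∣p∣⇒two-elements p 2≤∣p∣
  in suc x , suc y , Vec.there x∈p , Vec.there y∈p , x≢y ∘ suc-injective

△-duplicates-∉ : ∀ {𝓕 : Family n} {D F} → Saturated d 𝓕 → (∀ {y z} → y ∈ D → z ∈ D → Duplicates 𝓕 y z) →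
                 2 ≤ ∣ D ∣ → F ∈ᶠ 𝓕 → F △ D ∉ᶠ 𝓕
△-duplicates-∉ {𝓕 = 𝓕} {D} {F} sat dupD 2≤∣D∣ F∈ F△D∈ with 2≤∣p∣⇒two-elements D 2≤∣D∣
... | y , z , y∈D , z∈D , y≢z with saturated-extension sat (△⁅⁆∉ (dupD y∈D z∈D) y≢z F∈)
...   | S , sh , d<∣S∣ = <⇒≱ d<∣S∣ (≤-VC (proj₁ sat) sh (λ _ _ → id) simulation)
  where
  simulation : Simulates id S (F △ ⁅ y ⁆ ∷ 𝓕) 𝓕
  simulation A (there A∈) = A , A∈ , λ _ _ → refl
  simulation A (here refl) with y ∈? S
  ... | no y∉S = F , F∈ , λ s s∈S → sym (begin
    lookup (F △ ⁅ y ⁆) s          ≡⟨ lookup-△ F ⁅ y ⁆ s ⟩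
    lookup F s xor lookup ⁅ y ⁆ s ≡⟨ cong (lookup F s xor_) (lookup-⁅y⁆ y λ s≡y → y∉S (subst (_∈ S) s≡y s∈S)) ⟩
    lookup F s xor false          ≡⟨ xor-identityʳ _ ⟩
    lookup F s                    ∎)
  ... | yes y∈S = F △ D , F△D∈ , λ s s∈S → begin
    lookup (F △ D) s              ≡⟨ lookup-△ F D s ⟩
    lookup F s xor lookup D s     ≡⟨ cong (lookup F s xor_) (D≗⁅y⁆-on-S s∈S) ⟩
    lookup F s xor lookup ⁅ y ⁆ s ≡⟨ lookup-△ F ⁅ y ⁆ s ⟨
    lookup (F △ ⁅ y ⁆) s          ∎
    where
    D≗⁅y⁆-on-S : ∀ {s} → s ∈ S → lookup D s ≡ lookup ⁅ y ⁆ s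
    D≗⁅y⁆-on-S {s} s∈S with s ≟ᶠ y
    ... | yes refl = trans ([]=⇒lookup y∈D) (sym (lookup-⁅x⁆ y))
    ... | no  s≢y  = trans (¬-not λ D[s] → s≢y (∷-shatters-duplicates⇒≡ (dupD (lookup⇒[]= s D D[s]) y∈D) sh s∈S y∈S))
                           (sym (lookup-⁅y⁆ y s≢y))

lookup-dupSet : ∀ (ys : List (Fin n)) F j → lookup (dupSet ys F) j ≡ lookup F (dupMap ys j)
lookup-dupSet ys F j = lookup∘tabulate (lookup F ∘ dupMap ys) j

dupMap-↑ʳ : ∀ (ys : List (Fin n)) x → dupMap ys (length ys ↑ʳ x) ≡ x
dupMap-↑ʳ []       x = refl
dupMap-↑ʳ (_ ∷ ys) x = dupMap-↑ʳ ys x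

dupMap-∈ : ∀ (ys : List (Fin n)) j → j ≢ length ys ↑ʳ dupMap ys j → dupMap ys j ∈ᶠ ys
dupMap-∈ []       j       j≢ = contradiction refl j≢
dupMap-∈ (_ ∷ ys) zero    _  = here refl
dupMap-∈ (_ ∷ ys) (suc j) j≢ = there (dupMap-∈ ys j (j≢ ∘ cong suc))

dupMap-≡⇒Duplicates : ∀ (ys : List (Fin n)) 𝓐 {s t} → dupMap ys s ≡ dupMap ys t → Duplicates (dupFamily ys 𝓐) s t
dupMap-≡⇒Duplicates ys 𝓐 {s} {t} e = lookup≡⇒Duplicates A[s]≡A[t]
  where
  A[s]≡A[t] : ∀ A → A ∈ᶠ dupFamily ys 𝓐 → lookup A s ≡ lookup A t
  A[s]≡A[t] A A∈ with ∈-map⁻ (dupSet ys) A∈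
  ... | F , _ , refl = begin
    lookup (dupSet ys F) s  ≡⟨ lookup-dupSet ys F s ⟩
    lookup F (dupMap ys s)  ≡⟨ cong (lookup F) e ⟩
    lookup F (dupMap ys t)  ≡⟨ lookup-dupSet ys F t ⟨
    lookup (dupSet ys F) t  ∎

VC-dupFamily : ∀ (ys : List (Fin n)) {𝓐} → VC 𝓐 d → VC (dupFamily ys 𝓐) d
VC-dupFamily {d = d} ys {𝓐} vc@((S , sh , ∣S∣≡d) , _) =
  (image (length ys ↑ʳ_) S , sh′ , ≤-antisym (bounded sh′) d≤) , λ _ → bounded
  where
  sh′ : Shatters (dupFamily ys 𝓐) (image (length ys ↑ʳ_) S)
  sh′ = shatters-image sh λ A A∈ → dupSet ys A , ∈-map⁺ (dupSet ys) A∈ ,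
    λ s _ → trans (lookup-dupSet ys A _) (cong (lookup A) (dupMap-↑ʳ ys s))
  d≤ : d ≤ ∣ image (length ys ↑ʳ_) S ∣
  d≤ = subst (_≤ _) ∣S∣≡d (∣S∣≤∣image∣ _ S λ _ _ → ↑ʳ-injective (length ys) _ _)
  bounded : ∀ {X} → Shatters (dupFamily ys 𝓐) X → ∣ X ∣ ≤ d
  bounded {X} shX = ≤-VC vc shX (λ s∈ t∈ e → shatters-duplicates⇒≡ (dupMap-≡⇒Duplicates ys 𝓐 e) shX s∈ t∈) simulation
    where
    simulation : Simulates (dupMap ys) X (dupFamily ys 𝓐) 𝓐
    simulation A A∈ with ∈-map⁻ (dupSet ys) A∈
    ... | F , F∈ , refl = F , F∈ , λ j _ → sym (lookup-dupSet ys F j)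

pullback : (Fin m → Fin n) → Subset n → Subset m
pullback g H = tabulate (lookup H ∘ g)

redirect : ∀ (ys : List (Fin n)) → Fin (length ys + n) → Fin n → Fin (length ys + n)
redirect ys j s with s ≟ᶠ dupMap ys j
... | yes _ = j
... | no  _ = length ys ↑ʳ s

dupMap-redirect : ∀ (ys : List (Fin n)) j s → dupMap ys (redirect ys j s) ≡ s
dupMap-redirect ys j s with s ≟ᶠ dupMap ys j
... | yes s≡x = sym s≡x
... | no  _   = dupMap-↑ʳ ys s

pullback-redirect : ∀ (ys : List (Fin n)) {H} j → lookup H j ≢ lookup H (length ys ↑ʳ dupMap ys j) →
                    pullback (redirect ys j) H ≡ pullback (length ys ↑ʳ_) H △ ⁅ dupMap ys j ⁆
pullback-redirect ys {H} j defect = Subset-ext pointwise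
  where
  x = dupMap ys j
  K = pullback (length ys ↑ʳ_) H
  H∘redirect≗K△⁅x⁆ : ∀ s → lookup H (redirect ys j s) ≡ lookup K s xor lookup ⁅ x ⁆ s
  H∘redirect≗K△⁅x⁆ s with s ≟ᶠ x
  ... | yes refl = begin
    lookup H j                        ≡⟨ ¬-not defect ⟩
    not (lookup H (length ys ↑ʳ x))   ≡⟨ cong not (lookup∘tabulate _ x) ⟨
    not (lookup K x)                  ≡⟨ xor-comm (lookup K x) true ⟨
    lookup K x xor true               ≡⟨ cong (lookup K x xor_) (lookup-⁅x⁆ x) ⟨
    lookup K x xor lookup ⁅ x ⁆ x     ∎
  ... | no  s≢x  = begin
    lookup H (length ys ↑ʳ s)         ≡⟨ lookup∘tabulate _ s ⟨
    lookup K s                        ≡⟨ xor-identityʳ _ ⟨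
    lookup K s xor false              ≡⟨ cong (lookup K s xor_) (lookup-⁅y⁆ x s≢x) ⟨
    lookup K s xor lookup ⁅ x ⁆ s     ∎
  pointwise : ∀ s → lookup (pullback (redirect ys j) H) s ≡ lookup (K △ ⁅ x ⁆) s
  pointwise s = begin
    lookup (pullback (redirect ys j) H) s ≡⟨ lookup∘tabulate _ s ⟩
    lookup H (redirect ys j s)            ≡⟨ H∘redirect≗K△⁅x⁆ s ⟩
    lookup K s xor lookup ⁅ x ⁆ s         ≡⟨ lookup-△ K ⁅ x ⁆ s ⟨
    lookup (K △ ⁅ x ⁆) s                  ∎

dupSet-pullback : ∀ (ys : List (Fin n)) {H} → (∀ j → lookup H j ≡ lookup H (length ys ↑ʳ dupMap ys j)) →
                  dupSet ys (pullback (length ys ↑ʳ_) H) ≡ H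
dupSet-pullback ys {H} uniform = Subset-ext λ j → begin
  lookup (dupSet ys (pullback (length ys ↑ʳ_) H)) j   ≡⟨ lookup-dupSet ys (pullback (length ys ↑ʳ_) H) j ⟩
  lookup (pullback (length ys ↑ʳ_) H) (dupMap ys j)   ≡⟨ lookup∘tabulate (lookup H ∘ (length ys ↑ʳ_)) (dupMap ys j) ⟩
  lookup H (length ys ↑ʳ dupMap ys j)                 ≡⟨ uniform j ⟨
  lookup H j                                          ∎

dupFamily-grows : ∀ (ys : List (Fin n)) {𝓕 𝓖 H} {g : Fin n → Fin (length ys + n)} →
                  Saturated d 𝓕 → VC 𝓖 d′ → (∀ F → F ∈ᶠ dupFamily ys 𝓕 → F ∈ᶠ 𝓖) → H ∈ᶠ 𝓖 →
                  (∀ s → dupMap ys (g s) ≡ s) → pullback g H ∉ᶠ 𝓕 → d < d′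
dupFamily-grows ys {𝓕} {𝓖} {H} {g} sat vc ⊇ H∈ section L∉ = saturated-<-VC sat vc L∉ injective simulation
  where
  injective : ∀ {s t} → g s ≡ g t → s ≡ t
  injective {s} {t} gs≡gt = trans (sym (section s)) (trans (cong (dupMap ys) gs≡gt) (section t))
  simulation : ∀ {S} → Simulates g S (pullback g H ∷ 𝓕) 𝓖
  simulation _ (here refl) = H , H∈ , λ s _ → sym (lookup∘tabulate _ s)
  simulation A (there A∈)  = dupSet ys A , ⊇ _ (∈-map⁺ (dupSet ys) A∈) ,
    λ s _ → trans (lookup-dupSet ys A (g s)) (cong (lookup A) (section s))

dupFamily-saturated : ∀ (ys : List (Fin n)) {𝓕} → Saturated d 𝓕 →
                      All (λ y → ∀ F → F ∈ᶠ 𝓕 → F △ ⁅ y ⁆ ∉ᶠ 𝓕) ys → Saturated d (dupFamily ys 𝓕)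
dupFamily-saturated {d = d} ys {𝓕} sat toggles = VC-dupFamily ys (proj₁ sat) , grows
  where
  grows : ∀ 𝓖 → 𝓖 ⊋ᶠ dupFamily ys 𝓕 → ∀ d′ → VC 𝓖 d′ → d < d′
  grows 𝓖 (⊇ , H , H∈ , H∉) d′ vc with any? (pullback (length ys ↑ʳ_) H ≟ˢ_) 𝓕
  ... | no K∉ = dupFamily-grows ys sat vc ⊇ H∈ (dupMap-↑ʳ ys) K∉
  ... | yes K∈ with all? (λ j → lookup H j ≟ᵇ lookup H (length ys ↑ʳ dupMap ys j))
  ...   | yes uniform = contradiction (subst (_∈ᶠ _) (dupSet-pullback ys uniform) (∈-map⁺ (dupSet ys) K∈)) H∉
  ...   | no ¬uniform =
    let (j , defect) = ¬∀⟶∃¬ _ _ (λ j → lookup H j ≟ᵇ lookup H (length ys ↑ʳ dupMap ys j)) ¬uniform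
        x∈ys = dupMap-∈ ys j (defect ∘ cong (lookup H))
    in dupFamily-grows ys sat vc ⊇ H∈ (dupMap-redirect ys j)
         (subst (_∉ᶠ 𝓕) (sym (pullback-redirect ys {H} j defect)) (All.lookup toggles x∈ys _ K∈))

proposition1 : ∀ (d n : ℕ) (𝓕 : Family n) → 2 ≤ d → Saturated d 𝓕 →
    ((∀ x y → Duplicates 𝓕 x y → x ≡ y) →
      ∀ (m : ℕ) (xs : Fin m → Fin n) →
      (∀ i F → F ∈ᶠ 𝓕 → (F △ ⁅ xs i ⁆) ∉ᶠ 𝓕) →
      ∀ (ys : List (Fin n)) → All (λ y → ∃ λ i → y ≡ xs i) ys →
      Saturated d (dupFamily ys 𝓕))
    ×
    (∀ (x : Fin n) (D : Subset n) → (∀ y → (y ∈ D → Duplicates 𝓕 x y) × (Duplicates 𝓕 x y → y ∈ D)) →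
      2 ≤ ∣ D ∣ → ∀ F → F ∈ᶠ 𝓕 → (F △ D) ∉ᶠ 𝓕)
proposition1 d n 𝓕 _ sat =
  (λ _ _ _ toggles ys ys⊆xs → dupFamily-saturated ys sat (All.map (λ { (i , refl) → toggles i }) ys⊆xs)) ,
  (λ x D isD[x] 2≤∣D∣ F F∈ → △-duplicates-∉ sat (duplicates-of x isD[x]) 2≤∣D∣ F∈)
  where
  duplicates-of : ∀ x {D} → (∀ y → (y ∈ D → Duplicates 𝓕 x y) × (Duplicates 𝓕 x y → y ∈ D)) →
                  ∀ {y z} → y ∈ D → z ∈ D → Duplicates 𝓕 y z
  duplicates-of x isD[x] {y} {z} y∈D z∈D =
    Duplicates-trans (Duplicates-sym (proj₁ (isD[x] y) y∈D)) (proj₁ (isD[x] z) z∈D)
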